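{- Let $A$ be an integral srl-monoid and $H\subseteq A$. The following are equivalent: 1) $H$ is a strongly convex subalgebra of $A$; 2) $H$ is a convex subalgebra of $A$; 3) $H$ is a $\square$-filter of $A$.
   Context: A commutative l-monoid is an algebra $(A,\wedge,\vee,\cdot,e)$ of type $(2,2,2,0)$ such that $(A,\wedge,\vee)$ is a lattice, $(A,\cdot,e)$ is a commutative monoid and $(a\vee b)\cdot c=(a\cdot c)\vee(b\cdot c)$ for all $a,b,c\in A$. An algebra $(A,\wedge,\vee,\cdot,\rightarrow,e)$ of type $(2,2,2,2,0)$ is an srl-monoid if $(A,\wedge,\vee,\cdot,e)$ is a commutative l-monoid and there is a subalgebra $Q$ of $(A,\wedge,\vee,\cdot,e)$ such that for all $a,b\in A$ the set $\{q\in Q: a\cdot q\leq b\}$ has a maximum and $a\rightarrow b$ equals this maximum. It is integral if it has a greatest element $1$ and $e=1$. Let $\square(a)=e\rightarrow a$. A convex subalgebra of $A$ is a subalgebra $H$ of $(A,\wedge,\vee,\cdot,\rightarrow,e)$ such that whenever $a,b\in H$, $c\in A$ and $a\le c\le b$, then $c\in H$. A strongly convex subalgebra is a convex subalgebra $H$ such that for every $a\in A$ and $h\in H$ with $a\cdot h\leq e\leq h\rightarrow a$ one has $a\in H$. For integral $A$, a filter is a subset $H$ with $1\in H$, $H$ upward closed, and $a\cdot b\in H$ whenever $a,b\in H$; a $\square$-filter is a filter closed under $\square$. -}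

module Defs where

open import Level using (Level; _⊔_; suc)
open import Data.Product using (_×_)
open import Relation.Binary.PropositionalEquality using (_≡_)
open import Algebra.Core using (Op₂)
import Algebra.Definitions as AD
import Algebra.Structures as AS
import Algebra.Lattice.Structures as LS

-- The subalgebra Q of (A, ∧, ∨, ·, e) witnessing the residuation is part
-- of the structure (it exists), with  a → b = max {q ∈ Q : a · q ≤ b}.
record SrlMonoid (a ℓ : Level) : Set (suc (a ⊔ ℓ)) where
  infixr 7 _∧_
  infixr 6 _∨_
  infixl 8 _·_
  infixr 5 _⇒_
  infix 4 _≤_
  field
    Carrier : Set a
    _∧_ _∨_ _·_ _⇒_ : Op₂ Carrier
    e : Carrier
    isLattice : LS.IsLattice {A = Carrier} _≡_ _∨_ _∧_
    isCommutativeMonoid : AS.IsCommutativeMonoid {A = Carrier} _≡_ _·_ e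
    ·-distribʳ-∨ : AD._DistributesOverʳ_ {A = Carrier} _≡_ _·_ _∨_

  _≤_ : Carrier → Carrier → Set a
  x ≤ y = x ∧ y ≡ x

  field
    Q : Carrier → Set ℓ
    Q-∧ : ∀ {x y} → Q x → Q y → Q (x ∧ y)
    Q-∨ : ∀ {x y} → Q x → Q y → Q (x ∨ y)
    Q-· : ∀ {x y} → Q x → Q y → Q (x · y)
    Q-e : Q e
    ⇒-inQ : ∀ x y → Q (x ⇒ y)
    ⇒-sound : ∀ x y → x · (x ⇒ y) ≤ y
    ⇒-max : ∀ x y q → Q q → x · q ≤ y → q ≤ x ⇒ y

  □ : Carrier → Carrier
  □ x = e ⇒ x

-- Integral: there is a greatest element 1 and e = 1, i.e. e is the top.
Integral : ∀ {a ℓ} → SrlMonoid a ℓ → Set a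
Integral A = ∀ x → x ≤ e
  where open SrlMonoid A

module _ {a ℓ h} (A : SrlMonoid a ℓ) (H : SrlMonoid.Carrier A → Set h) where
  open SrlMonoid A

  IsSubalgebra : Set (a ⊔ h)
  IsSubalgebra =
    (∀ {x y} → H x → H y → H (x ∧ y)) ×
    (∀ {x y} → H x → H y → H (x ∨ y)) ×
    (∀ {x y} → H x → H y → H (x · y)) ×
    (∀ {x y} → H x → H y → H (x ⇒ y)) ×
    H e

  IsConvexSubalgebra : Set (a ⊔ h)
  IsConvexSubalgebra =
    IsSubalgebra ×
    (∀ {x y z} → H x → H y → x ≤ z → z ≤ y → H z)

  IsStronglyConvexSubalgebra : Set (a ⊔ h)
  IsStronglyConvexSubalgebra =
    IsConvexSubalgebra ×
    (∀ {x k} → H k → x · k ≤ e → e ≤ k ⇒ x → H x)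

  -- filter (for integral A, where 1 = e)
  IsFilter : Set (a ⊔ h)
  IsFilter =
    H e ×
    (∀ {x y} → H x → x ≤ y → H y) ×
    (∀ {x y} → H x → H y → H (x · y))

  Is□Filter : Set (a ⊔ h)
  Is□Filter = IsFilter × (∀ {x} → H x → H (□ x))

{-# OPTIONS --safe #-}
-- Since e is the top element, a convex subalgebra is exactly an upward closed
-- subalgebra, and the strong-convexity condition follows from e ≤ k ⇒ x ⇒ k ≤ x.
-- Conversely a □-filter is closed under ∧, ∨ and ⇒ because
-- x · y ≤ x ∧ y ≤ x ∨ y and □ y ≤ x ⇒ y.
module Submission where

open import Defs
open import Data.Product using (_×_; _,_; proj₁)
open import Function.Bundles using (_⇔_; mk⇔)
open import Relation.Binary.PropositionalEquality using (_≡_; sym; subst; subst₂)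
open import Algebra.Lattice.Bundles using (Lattice)
import Algebra.Lattice.Properties.Lattice as LatticeProperties
import Algebra.Structures as AS
import Relation.Binary.Lattice as OrderLattice
import Relation.Binary.Lattice.Properties.JoinSemilattice as JoinSemilatticeProperties

module SrlMonoidProperties {a ℓ} (A : SrlMonoid a ℓ) where
  open SrlMonoid A
  open AS.IsCommutativeMonoid isCommutativeMonoid using (comm; identityʳ)

  private
    lattice : Lattice a a
    lattice = record { isLattice = isLattice }

    -- The library orders a lattice by  x ≡ x ∧ y , the symmetric form of  _≤_ .
    module O = OrderLattice.Lattice (LatticeProperties.∨-∧-orderTheoreticLattice lattice)

  ≤-refl : ∀ {x} → x ≤ x
  ≤-refl = sym O.refl

  ≤-trans : ∀ {x y z} → x ≤ y → y ≤ z → x ≤ z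
  ≤-trans p q = sym (O.trans (sym p) (sym q))

  ≤-antisym : ∀ {x y} → x ≤ y → y ≤ x → x ≡ y
  ≤-antisym p q = O.antisym (sym p) (sym q)

  x≤x∨y : ∀ x y → x ≤ x ∨ y
  x≤x∨y x y = sym (O.x≤x∨y x y)

  ∧-greatest : ∀ {x y z} → x ≤ y → x ≤ z → x ≤ y ∧ z
  ∧-greatest p q = sym (O.∧-greatest (sym p) (sym q))

  x≤y⇒x∨y≡y : ∀ {x y} → x ≤ y → x ∨ y ≡ y
  x≤y⇒x∨y≡y p = JoinSemilatticeProperties.x≤y⇒x∨y≈y O.joinSemilattice (sym p)

  ·-monoˡ-≤ : ∀ {x y} z → x ≤ y → x · z ≤ y · z
  ·-monoˡ-≤ {x} {y} z x≤y = subst (x · z ≤_) join≡ (x≤x∨y (x · z) (y · z))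
    where
    join≡ : x · z ∨ y · z ≡ y · z
    join≡ = subst (λ t → x · z ∨ y · z ≡ t · z) (x≤y⇒x∨y≡y x≤y) (sym (·-distribʳ-∨ z x y))

  ·-monoʳ-≤ : ∀ {x y} z → x ≤ y → z · x ≤ z · y
  ·-monoʳ-≤ {x} {y} z x≤y = subst₂ _≤_ (comm x z) (comm y z) (·-monoˡ-≤ z x≤y)

  e≤x⇒y⇒x≤y : ∀ {x y} → e ≤ x ⇒ y → x ≤ y
  e≤x⇒y⇒x≤y {x} {y} e≤x⇒y =
    ≤-trans (subst (_≤ x · (x ⇒ y)) (identityʳ x) (·-monoʳ-≤ x e≤x⇒y)) (⇒-sound x y)

module IntegralSrlMonoidProperties {a ℓ} (A : SrlMonoid a ℓ) (integral : Integral A) where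
  open SrlMonoid A
  open SrlMonoidProperties A
  open AS.IsCommutativeMonoid isCommutativeMonoid using (comm; identityʳ)

  x·y≤x : ∀ x y → x · y ≤ x
  x·y≤x x y = subst (x · y ≤_) (identityʳ x) (·-monoʳ-≤ x (integral y))

  x·y≤y : ∀ x y → x · y ≤ y
  x·y≤y x y = subst (_≤ y) (comm y x) (x·y≤x y x)

  □y≤x⇒y : ∀ x y → □ y ≤ x ⇒ y
  □y≤x⇒y x y = ⇒-max x y (□ y) (⇒-inQ e y)
    (≤-trans (·-monoˡ-≤ (□ y) (integral x)) (⇒-sound e y))

module _ {a ℓ h} (A : SrlMonoid a ℓ) (integral : Integral A)
         (H : SrlMonoid.Carrier A → Set h) where
  open SrlMonoid A
  open SrlMonoidProperties A
  open IntegralSrlMonoidProperties A integral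

  -- With e the top element, the hypothesis  x · k ≤ e  is vacuous.
  convex⇒stronglyConvex : IsConvexSubalgebra A H → IsStronglyConvexSubalgebra A H
  convex⇒stronglyConvex convex@((_ , _ , _ , _ , He) , between) =
    convex , λ {x} Hk _ e≤k⇒x → between Hk He (e≤x⇒y⇒x≤y e≤k⇒x) (integral x)

  convex⇒□Filter : IsConvexSubalgebra A H → Is□Filter A H
  convex⇒□Filter ((_ , _ , H· , H⇒ , He) , between) =
    (He , (λ {_} {y} Hx x≤y → between Hx He x≤y (integral y)) , H·) , H⇒ He

  □Filter⇒convex : Is□Filter A H → IsConvexSubalgebra A H
  □Filter⇒convex ((He , upward , H·) , H□) =
    (H∧ , H∨ , H· , H⇒ , He) , λ Hx _ x≤z _ → upward Hx x≤z
    where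
    H∧ : ∀ {x y} → H x → H y → H (x ∧ y)
    H∧ {x} {y} Hx Hy = upward (H· Hx Hy) (∧-greatest (x·y≤x x y) (x·y≤y x y))

    H∨ : ∀ {x y} → H x → H y → H (x ∨ y)
    H∨ {x} {y} Hx _ = upward Hx (x≤x∨y x y)

    H⇒ : ∀ {x y} → H x → H y → H (x ⇒ y)
    H⇒ {x} {y} _ Hy = upward (H□ Hy) (□y≤x⇒y x y)

lemma3p9 : ∀ {a ℓ h} (A : SrlMonoid a ℓ) → Integral A →
    (H : SrlMonoid.Carrier A → Set h) →
    (IsStronglyConvexSubalgebra A H ⇔ IsConvexSubalgebra A H) ×
    (IsConvexSubalgebra A H ⇔ Is□Filter A H)
lemma3p9 A integral H =
  mk⇔ proj₁ (convex⇒stronglyConvex A integral H) ,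
  mk⇔ (convex⇒□Filter A integral H) (□Filter⇒convex A integral H)
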